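{- Let $G$ be a finite simple graph with girth $g \ge 5$ and minimum degree $\delta \ge 2$. Then $2\delta - 2 \le Z(G)$.
   Context: The girth of $G$ is the length of a shortest cycle in $G$. Zero forcing process: start with an initial set $S$ of colored vertices. A colored vertex $v$ forces an uncolored neighbor $w$ (making $w$ colored) if $w$ is the only uncolored neighbor of $v$; forces are applied repeatedly. $S$ is a zero forcing set if eventually every vertex becomes colored. $Z(G)$ is the minimum size of a zero forcing set. -}

module Defs where

open import Data.Nat using (ℕ; suc; _≤_; _<_)
open import Data.Bool using (Bool; true; false; T)
open import Data.Fin using (Fin; zero; suc; toℕ; inject₁; fromℕ)
open import Data.Fin.Subset using (Subset; _∈_; ∣_∣)
open import Data.Vec using (tabulate)
open import Data.Product using (Σ; ∃; _×_; _,_)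
open import Function.Definitions using (Injective)
open import Relation.Binary.PropositionalEquality using (_≡_; _≢_)
open import Relation.Nullary using (¬_)
import Data.Empty

record Graph (n : ℕ) : Set where
  field
    adj   : Fin n → Fin n → Bool
    sym   : ∀ u v → adj u v ≡ adj v u
    irrefl : ∀ v → adj v v ≡ false
open Graph public

Adj : ∀ {n} → Graph n → Fin n → Fin n → Set
Adj G u v = T (adj G u v)

N : ∀ {n} → Graph n → Fin n → Subset n
N G v = tabulate (adj G v)

deg : ∀ {n} → Graph n → Fin n → ℕ
deg G v = ∣ N G v ∣

IsMinDegree : ∀ {n} → Graph n → ℕ → Set
IsMinDegree {n} G δ = (∀ v → δ ≤ deg G v) × (∃ λ v → deg G v ≡ δ)

HasCycle : ∀ {n} → Graph n → ℕ → Set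
HasCycle {n} G 0 = Data.Empty.⊥
HasCycle {n} G (suc m) =
  3 ≤ suc m ×
  Σ (Fin (suc m) → Fin n) λ c →
    Injective _≡_ _≡_ c ×
    (∀ (i : Fin m) → Adj G (c (inject₁ i)) (c (suc i))) ×
    Adj G (c (fromℕ m)) (c zero)

-- girth(G) ≥ g : G has no cycle of length less than g
-- (an acyclic graph has infinite girth, so satisfies this for every g)
GirthAtLeast : ∀ {n} → Graph n → ℕ → Set
GirthAtLeast G g = ∀ k → k < g → ¬ HasCycle G k

-- Zero forcing: the set of vertices eventually coloured from initial set S.
-- w becomes coloured if it is in S, or some coloured neighbour v of w has
-- all its neighbours other than w coloured (so w is v's only uncoloured one).
data Colored {n} (G : Graph n) (S : Subset n) : Fin n → Set where
  initial : ∀ {w} → w ∈ S → Colored G S w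
  force   : ∀ {v w} → Colored G S v → Adj G v w →
            (∀ u → Adj G v u → u ≢ w → Colored G S u) →
            Colored G S w

IsZeroForcingSet : ∀ {n} → Graph n → Subset n → Set
IsZeroForcingSet G S = ∀ w → Colored G S w

IsZeroForcingNumber : ∀ {n} → Graph n → ℕ → Set
IsZeroForcingNumber G z =
  (Σ _ λ S → IsZeroForcingSet G S × ∣ S ∣ ≡ z) ×
  (∀ S → IsZeroForcingSet G S → z ≤ ∣ S ∣)

module Submission where

-- Let S be a zero forcing set.  The first force of the process started at S
-- is performed by a vertex v whose closed neighbourhood N[v] lies in S except
-- for the forced vertex w.  Continue from S ∪ {w}: the next force is done by
-- a vertex u ≠ v (all of N[v] is already coloured), so N[u] ⊆ S ∪ {w, x}.
-- (If a set is already everything, no force is needed: any vertex, resp.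
-- any neighbour of v, will do.)
-- Hence N[v] ∪ N[u] has at most |S| + 2 elements.  On the other hand girth
-- at least 5 forbids triangles and 4-cycles, so two distinct closed
-- neighbourhoods share at most 2 vertices, and inclusion–exclusion gives
-- |N[v] ∪ N[u]| ≥ deg v + deg u ≥ 2δ.

open import Defs
open import Data.Nat using (ℕ; suc; _+_; _*_; _∸_; _≤_; z≤n; s≤s)
import Data.Nat.Properties as ℕₚ
open import Data.Fin as F using (Fin; _≟_)
open import Data.Fin.Properties using (any?; all?; ¬∀⟶∃¬)
open import Data.Fin.Subset using (Subset; _∈_; _∉_; ∣_∣; _∪_; _∩_; ⁅_⁆; inside; outside; _⊆_; Empty)
open import Data.Fin.Subset.Properties
  using (_∈?_; nonempty?; Empty-unique; ∣⊥∣≡0; ∣⁅x⁆∣≡1; x∈⁅x⁆; x∈⁅y⁆⇒x≡y; x∈⁅y⁆⇔x≡y;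
         x∈p∩q⁻; x∈p∪q⁺; x∈p∪q⁻; p⊆p∪q; ⊆-trans; p⊆q⇒∣p∣≤∣q∣)
open import Data.Bool using (T)
open import Data.Bool.Properties using (T-≡)
open import Data.Vec using ([]; _∷_; lookup)
open import Data.Vec.Properties using (lookup⇒[]=; []=⇒lookup; lookup∘tabulate)
open import Data.Vec.Relation.Unary.Unique.Propositional using (Unique)
open import Data.Vec.Relation.Unary.Unique.Propositional.Properties using (lookup-injective)
open import Data.Vec.Relation.Unary.All using ([]; _∷_)
open import Data.Vec.Relation.Unary.AllPairs using ([]; _∷_)
open import Data.Product using (∃; ∃₂; _×_; _,_)
open import Data.Sum using (_⊎_; inj₁; inj₂)
open import Data.Empty using (⊥-elim)
open import Function.Bundles using (Equivalence)
open import Relation.Binary.PropositionalEquality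
  using (_≡_; _≢_; refl; trans; cong; cong₂; subst; module ≡-Reasoning) renaming (sym to ≡-sym)
open import Relation.Nullary using (yes; no)
open import Relation.Nullary.Decidable using (T?; ¬?; _×-dec_)

∣p∪q∣+∣p∩q∣≡∣p∣+∣q∣ : ∀ {n} (p q : Subset n) → ∣ p ∪ q ∣ + ∣ p ∩ q ∣ ≡ ∣ p ∣ + ∣ q ∣
∣p∪q∣+∣p∩q∣≡∣p∣+∣q∣ [] [] = refl
∣p∪q∣+∣p∩q∣≡∣p∣+∣q∣ (inside ∷ p) (inside ∷ q) = cong suc (begin
  ∣ p ∪ q ∣ + suc ∣ p ∩ q ∣  ≡⟨ ℕₚ.+-suc ∣ p ∪ q ∣ ∣ p ∩ q ∣ ⟩
  suc (∣ p ∪ q ∣ + ∣ p ∩ q ∣) ≡⟨ cong suc (∣p∪q∣+∣p∩q∣≡∣p∣+∣q∣ p q) ⟩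
  suc (∣ p ∣ + ∣ q ∣)         ≡⟨ ≡-sym (ℕₚ.+-suc ∣ p ∣ ∣ q ∣) ⟩
  ∣ p ∣ + suc ∣ q ∣           ∎)
  where open ≡-Reasoning
∣p∪q∣+∣p∩q∣≡∣p∣+∣q∣ (inside ∷ p) (outside ∷ q) = cong suc (∣p∪q∣+∣p∩q∣≡∣p∣+∣q∣ p q)
∣p∪q∣+∣p∩q∣≡∣p∣+∣q∣ (outside ∷ p) (inside ∷ q) =
  trans (cong suc (∣p∪q∣+∣p∩q∣≡∣p∣+∣q∣ p q)) (≡-sym (ℕₚ.+-suc ∣ p ∣ ∣ q ∣))
∣p∪q∣+∣p∩q∣≡∣p∣+∣q∣ (outside ∷ p) (outside ∷ q) = ∣p∪q∣+∣p∩q∣≡∣p∣+∣q∣ p q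

Empty⇒∣p∣≡0 : ∀ {n} {p : Subset n} → Empty p → ∣ p ∣ ≡ 0
Empty⇒∣p∣≡0 {n} empty = trans (cong ∣_∣ (Empty-unique empty)) (∣⊥∣≡0 n)

∣p∪⁅x⁆∣≤1+∣p∣ : ∀ {n} (p : Subset n) (x : Fin n) → ∣ p ∪ ⁅ x ⁆ ∣ ≤ suc ∣ p ∣
∣p∪⁅x⁆∣≤1+∣p∣ p x = begin
  ∣ p ∪ ⁅ x ⁆ ∣                     ≤⟨ ℕₚ.m≤m+n ∣ p ∪ ⁅ x ⁆ ∣ ∣ p ∩ ⁅ x ⁆ ∣ ⟩
  ∣ p ∪ ⁅ x ⁆ ∣ + ∣ p ∩ ⁅ x ⁆ ∣     ≡⟨ ∣p∪q∣+∣p∩q∣≡∣p∣+∣q∣ p ⁅ x ⁆ ⟩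
  ∣ p ∣ + ∣ ⁅ x ⁆ ∣                 ≡⟨ cong (∣ p ∣ +_) (∣⁅x⁆∣≡1 x) ⟩
  ∣ p ∣ + 1                         ≡⟨ ℕₚ.+-comm ∣ p ∣ 1 ⟩
  suc ∣ p ∣                         ∎
  where open ℕₚ.≤-Reasoning

∣p∪⁅x⁆∣≡1+∣p∣ : ∀ {n} (p : Subset n) (x : Fin n) → x ∉ p → ∣ p ∪ ⁅ x ⁆ ∣ ≡ suc ∣ p ∣
∣p∪⁅x⁆∣≡1+∣p∣ p x x∉p = begin
  ∣ p ∪ ⁅ x ⁆ ∣                     ≡⟨ ≡-sym (ℕₚ.+-identityʳ _) ⟩
  ∣ p ∪ ⁅ x ⁆ ∣ + 0                 ≡⟨ cong (∣ p ∪ ⁅ x ⁆ ∣ +_) (≡-sym (Empty⇒∣p∣≡0 disjoint)) ⟩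
  ∣ p ∪ ⁅ x ⁆ ∣ + ∣ p ∩ ⁅ x ⁆ ∣     ≡⟨ ∣p∪q∣+∣p∩q∣≡∣p∣+∣q∣ p ⁅ x ⁆ ⟩
  ∣ p ∣ + ∣ ⁅ x ⁆ ∣                 ≡⟨ cong (∣ p ∣ +_) (∣⁅x⁆∣≡1 x) ⟩
  ∣ p ∣ + 1                         ≡⟨ ℕₚ.+-comm ∣ p ∣ 1 ⟩
  suc ∣ p ∣                         ∎
  where
  open ≡-Reasoning
  disjoint : Empty (p ∩ ⁅ x ⁆)
  disjoint (y , y∈p∩x) with x∈p∩q⁻ p ⁅ x ⁆ y∈p∩x
  ... | y∈p , y∈x = x∉p (subst (_∈ p) (x∈⁅y⁆⇒x≡y x y∈x) y∈p)

∣p∣≤1 : ∀ {n} (p : Subset n) → (∀ {y y′} → y ∈ p → y′ ∈ p → y ≡ y′) → ∣ p ∣ ≤ 1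
∣p∣≤1 p same with nonempty? p
... | yes (y , y∈p) = ℕₚ.≤-trans (p⊆q⇒∣p∣≤∣q∣ p⊆⁅y⁆) (ℕₚ.≤-reflexive (∣⁅x⁆∣≡1 y))
  where
  p⊆⁅y⁆ : p ⊆ ⁅ y ⁆
  p⊆⁅y⁆ y′∈p = Equivalence.from x∈⁅y⁆⇔x≡y (same y′∈p y∈p)
... | no empty = ℕₚ.≤-trans (ℕₚ.≤-reflexive (Empty⇒∣p∣≡0 empty)) z≤n

∪-⊆ : ∀ {n} {p q r : Subset n} → p ⊆ r → q ⊆ r → p ∪ q ⊆ r
∪-⊆ {p = p} {q} p⊆r q⊆r y∈p∪q with x∈p∪q⁻ p q y∈p∪q
... | inj₁ y∈p = p⊆r y∈p
... | inj₂ y∈q = q⊆r y∈q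

module _ {n : ℕ} (G : Graph n) where

  adj⇒≢ : ∀ {u v} → Adj G u v → u ≢ v
  adj⇒≢ {u} uv refl = subst T (irrefl G u) uv

  adj-sym : ∀ {u v} → Adj G u v → Adj G v u
  adj-sym {u} {v} = subst T (Graph.sym G u v)

  adj⇒∈N : ∀ {v y} → Adj G v y → y ∈ N G v
  adj⇒∈N {v} {y} vy =
    lookup⇒[]= y _ (trans (lookup∘tabulate (adj G v) y) (Equivalence.to T-≡ vy))

  ∈N⇒adj : ∀ {v y} → y ∈ N G v → Adj G v y
  ∈N⇒adj {v} {y} y∈N =
    Equivalence.from T-≡ (trans (≡-sym (lookup∘tabulate (adj G v) y)) ([]=⇒lookup y∈N))

  Nc : Fin n → Subset n
  Nc v = N G v ∪ ⁅ v ⁆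

  ∈Nc⁻ : ∀ {v y} → y ∈ Nc v → y ≡ v ⊎ Adj G v y
  ∈Nc⁻ {v} y∈Nc with x∈p∪q⁻ (N G v) ⁅ v ⁆ y∈Nc
  ... | inj₁ y∈N = inj₂ (∈N⇒adj y∈N)
  ... | inj₂ y∈v = inj₁ (x∈⁅y⁆⇒x≡y v y∈v)

  ∣Nc∣≡1+deg : ∀ v → ∣ Nc v ∣ ≡ suc (deg G v)
  ∣Nc∣≡1+deg v = ∣p∪⁅x⁆∣≡1+∣p∣ (N G v) v (λ v∈N → adj⇒≢ (∈N⇒adj v∈N) refl)

  neighbour : ∀ v → 1 ≤ deg G v → ∃ (Adj G v)
  neighbour v 1≤deg with nonempty? (N G v)
  ... | yes (y , y∈N) = y , ∈N⇒adj y∈N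
  ... | no empty = ⊥-elim (ℕₚ.1+n≰n (ℕₚ.≤-trans 1≤deg (ℕₚ.≤-reflexive (Empty⇒∣p∣≡0 empty))))

  triangle : ∀ {a b c} → Adj G a b → Adj G b c → Adj G c a → HasCycle G 3
  triangle {a} {b} {c} ab bc ca =
    s≤s (s≤s (s≤s z≤n)) , lookup cs , lookup-injective distinct _ _ , edge , ca
    where
    cs = a ∷ b ∷ c ∷ []
    distinct : Unique cs
    distinct = (adj⇒≢ ab ∷ (λ a≡c → adj⇒≢ ca (≡-sym a≡c)) ∷ [])
             ∷ (adj⇒≢ bc ∷ []) ∷ [] ∷ []
    edge : ∀ i → Adj G (lookup cs (F.inject₁ i)) (lookup cs (F.suc i))
    edge F.zero = ab
    edge (F.suc F.zero) = bc

  square : ∀ {a b c d} → Adj G a b → Adj G b c → Adj G c d → Adj G d a →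
           a ≢ c → b ≢ d → HasCycle G 4
  square {a} {b} {c} {d} ab bc cd da a≢c b≢d =
    s≤s (s≤s (s≤s z≤n)) , lookup cs , lookup-injective distinct _ _ , edge , da
    where
    cs = a ∷ b ∷ c ∷ d ∷ []
    distinct : Unique cs
    distinct = (adj⇒≢ ab ∷ a≢c ∷ (λ a≡d → adj⇒≢ da (≡-sym a≡d)) ∷ [])
             ∷ (adj⇒≢ bc ∷ b≢d ∷ []) ∷ (adj⇒≢ cd ∷ []) ∷ [] ∷ []
    edge : ∀ i → Adj G (lookup cs (F.inject₁ i)) (lookup cs (F.suc i))
    edge F.zero = ab
    edge (F.suc F.zero) = bc
    edge (F.suc (F.suc F.zero)) = cd

  module _ (girth≥5 : GirthAtLeast G 5) where

    -- Two distinct closed neighbourhoods share at most two vertices: if u ~ v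
    -- a third common vertex closes a triangle, otherwise two common
    -- neighbours close a 4-cycle through u and v.
    ∣Nc∩Nc∣≤2 : ∀ {u v} → u ≢ v → ∣ Nc v ∩ Nc u ∣ ≤ 2
    ∣Nc∩Nc∣≤2 {u} {v} u≢v with T? (adj G v u)
    ... | yes vu = ℕₚ.≤-trans (p⊆q⇒∣p∣≤∣q∣ ⊆⁅v⁆∪⁅u⁆)
                     (ℕₚ.≤-trans (∣p∪⁅x⁆∣≤1+∣p∣ ⁅ v ⁆ u) (ℕₚ.≤-reflexive (cong suc (∣⁅x⁆∣≡1 v))))
      where
      ⊆⁅v⁆∪⁅u⁆ : Nc v ∩ Nc u ⊆ ⁅ v ⁆ ∪ ⁅ u ⁆
      ⊆⁅v⁆∪⁅u⁆ y∈ with x∈p∩q⁻ (Nc v) (Nc u) y∈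
      ... | y∈Ncv , y∈Ncu with ∈Nc⁻ y∈Ncv | ∈Nc⁻ y∈Ncu
      ... | inj₁ refl | _         = x∈p∪q⁺ (inj₁ (x∈⁅x⁆ v))
      ... | inj₂ _    | inj₁ refl = x∈p∪q⁺ (inj₂ (x∈⁅x⁆ u))
      ... | inj₂ vy   | inj₂ uy   = ⊥-elim (girth≥5 3 (s≤s (s≤s (s≤s (s≤s z≤n))))
                                      (triangle vy (adj-sym uy) (adj-sym vu)))
    ... | no ¬vu = ℕₚ.≤-trans (∣p∣≤1 (Nc v ∩ Nc u) unique) (ℕₚ.n≤1+n 1)
      where
      common : ∀ {y} → y ∈ Nc v ∩ Nc u → Adj G v y × Adj G u y
      common y∈ with x∈p∩q⁻ (Nc v) (Nc u) y∈
      ... | y∈Ncv , y∈Ncu with ∈Nc⁻ y∈Ncv | ∈Nc⁻ y∈Ncu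
      ... | inj₁ refl | inj₁ u≡v  = ⊥-elim (u≢v (≡-sym u≡v))
      ... | inj₁ refl | inj₂ uv   = ⊥-elim (¬vu (adj-sym uv))
      ... | inj₂ vy   | inj₁ refl = ⊥-elim (¬vu vy)
      ... | inj₂ vy   | inj₂ uy   = vy , uy
      unique : ∀ {y y′} → y ∈ Nc v ∩ Nc u → y′ ∈ Nc v ∩ Nc u → y ≡ y′
      unique {y} {y′} y∈ y′∈ with y ≟ y′ | common y∈ | common y′∈
      ... | yes y≡y′ | _ | _ = y≡y′
      ... | no y≢y′ | vy , uy | vy′ , uy′ =
        ⊥-elim (girth≥5 4 (s≤s (s≤s (s≤s (s≤s (s≤s z≤n)))))
          (square vy (adj-sym uy) uy′ (adj-sym vy′) (λ v≡u → u≢v (≡-sym v≡u)) y≢y′))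

    deg+deg≤∣Nc∪Nc∣ : ∀ {u v} → u ≢ v → deg G v + deg G u ≤ ∣ Nc v ∪ Nc u ∣
    deg+deg≤∣Nc∪Nc∣ {u} {v} u≢v = ℕₚ.+-cancelʳ-≤ 2 _ _ (begin
      deg G v + deg G u + 2               ≡⟨ shift (deg G v) (deg G u) ⟩
      suc (deg G v) + suc (deg G u)       ≡⟨ ≡-sym (cong₂ _+_ (∣Nc∣≡1+deg v) (∣Nc∣≡1+deg u)) ⟩
      ∣ Nc v ∣ + ∣ Nc u ∣                 ≡⟨ ≡-sym (∣p∪q∣+∣p∩q∣≡∣p∣+∣q∣ (Nc v) (Nc u)) ⟩
      ∣ Nc v ∪ Nc u ∣ + ∣ Nc v ∩ Nc u ∣   ≤⟨ ℕₚ.+-monoʳ-≤ ∣ Nc v ∪ Nc u ∣ (∣Nc∩Nc∣≤2 u≢v) ⟩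
      ∣ Nc v ∪ Nc u ∣ + 2                 ∎)
      where
      open ℕₚ.≤-Reasoning
      shift : ∀ a b → a + b + 2 ≡ suc a + suc b
      shift a b = trans (ℕₚ.+-comm (a + b) 2) (cong suc (≡-sym (ℕₚ.+-suc a b)))

  colored-mono : ∀ {S T w} → S ⊆ T → Colored G S w → Colored G T w
  colored-mono S⊆T (initial w∈S) = initial (S⊆T w∈S)
  colored-mono S⊆T (force v-col vw others) =
    force (colored-mono S⊆T v-col) vw (λ u vu u≢w → colored-mono S⊆T (others u vu u≢w))

  zero-forcing-mono : ∀ {S T} → S ⊆ T → IsZeroForcingSet G S → IsZeroForcingSet G T
  zero-forcing-mono S⊆T zf w = colored-mono S⊆T (zf w)

  Force : Subset n → Set
  Force T = ∃₂ λ v x → Adj G v x × x ∉ T × Nc v ⊆ T ∪ ⁅ x ⁆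

  -- Any vertex coloured from S but not in S is preceded by a force from S:
  -- go back along the derivation until the forcing vertex and all its other
  -- neighbours lie in S.
  first-force : ∀ {S w} → Colored G S w → w ∉ S → Force S
  first-force (initial w∈S) w∉S = ⊥-elim (w∉S w∈S)
  first-force {S} (force {v} {w} v-col vw others) w∉S with v ∈? S
  ... | no v∉S = first-force v-col v∉S
  ... | yes v∈S with any? (λ u → T? (adj G v u) ×-dec ¬? (u ≟ w) ×-dec ¬? (u ∈? S))
  ...   | yes (u , vu , u≢w , u∉S) = first-force (others u vu u≢w) u∉S
  ...   | no none = v , w , vw , w∉S , Nc⊆S∪⁅w⁆
    where
    Nc⊆S∪⁅w⁆ : Nc v ⊆ S ∪ ⁅ w ⁆
    Nc⊆S∪⁅w⁆ {y} y∈Nc with ∈Nc⁻ y∈Nc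
    ... | inj₁ refl = x∈p∪q⁺ (inj₁ v∈S)
    ... | inj₂ vy with y ≟ w | y ∈? S
    ...   | yes refl | _      = x∈p∪q⁺ (inj₂ (x∈⁅x⁆ w))
    ...   | no _     | yes y∈S = x∈p∪q⁺ (inj₁ y∈S)
    ...   | no y≢w   | no y∉S  = ⊥-elim (none (y , vy , y≢w , y∉S))

  full-or-force : ∀ {T} → IsZeroForcingSet G T → (∀ y → y ∈ T) ⊎ Force T
  full-or-force {T} zf with all? (_∈? T)
  ... | yes full = inj₁ full
  ... | no ¬full with ¬∀⟶∃¬ n (_∈ T) (_∈? T) ¬full
  ...   | w , w∉T = inj₂ (first-force (zf w) w∉T)

  first-saturated : ∀ {S} → Fin n → IsZeroForcingSet G S → ∃₂ λ v w → Nc v ⊆ S ∪ ⁅ w ⁆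
  first-saturated a zf with full-or-force zf
  ... | inj₁ full = a , a , λ {y} _ → x∈p∪q⁺ (inj₁ (full y))
  ... | inj₂ (v , w , _ , _ , Nc⊆) = v , w , Nc⊆

  -- If N[v] is coloured, some other closed neighbourhood is coloured up to
  -- one vertex: the next force cannot come from v.
  second-saturated : ∀ {T v} → IsZeroForcingSet G T → Nc v ⊆ T → ∃ (Adj G v) →
                     ∃ λ u → u ≢ v × ∃ λ x → Nc u ⊆ T ∪ ⁅ x ⁆
  second-saturated {v = v} zf Ncv⊆T (y , vy) with full-or-force zf
  ... | inj₁ full = y , (λ y≡v → adj⇒≢ vy (≡-sym y≡v)) , y , λ {z} _ → x∈p∪q⁺ (inj₁ (full z))
  ... | inj₂ (u , x , ux , x∉T , Nc⊆) = u , u≢v , x , Nc⊆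
    where
    u≢v : u ≢ v
    u≢v refl = x∉T (Ncv⊆T (x∈p∪q⁺ (inj₁ (adj⇒∈N ux))))

  saturated-pair : ∀ {S} → Fin n → (∀ v → ∃ (Adj G v)) → IsZeroForcingSet G S →
                   ∃₂ λ v u → u ≢ v × ∃₂ λ w x → Nc v ∪ Nc u ⊆ (S ∪ ⁅ w ⁆) ∪ ⁅ x ⁆
  saturated-pair a has-neighbour zf with first-saturated a zf
  ... | v , w , Ncv⊆ with second-saturated (zero-forcing-mono (p⊆p∪q ⁅ w ⁆) zf) Ncv⊆ (has-neighbour v)
  ...   | u , u≢v , x , Ncu⊆ = v , u , u≢v , w , x , ∪-⊆ (⊆-trans Ncv⊆ (p⊆p∪q ⁅ x ⁆)) Ncu⊆

∣S∪⁅w⁆∪⁅x⁆∣≤2+∣S∣ : ∀ {n} (S : Subset n) (w x : Fin n) → ∣ (S ∪ ⁅ w ⁆) ∪ ⁅ x ⁆ ∣ ≤ 2 + ∣ S ∣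
∣S∪⁅w⁆∪⁅x⁆∣≤2+∣S∣ S w x = ℕₚ.≤-trans (∣p∪⁅x⁆∣≤1+∣p∣ (S ∪ ⁅ w ⁆) x) (s≤s (∣p∪⁅x⁆∣≤1+∣p∣ S w))

theorem3 : ∀ {n} (G : Graph n) (δ z : ℕ) →
    GirthAtLeast G 5 →
    IsMinDegree G δ → 2 ≤ δ →
    IsZeroForcingNumber G z →
    2 * δ ∸ 2 ≤ z
theorem3 G δ z girth≥5 (δ≤deg , a , _) 2≤δ ((S , zf , ∣S∣≡z) , _)
  with saturated-pair G a (λ v → neighbour G v (ℕₚ.≤-trans (ℕₚ.n≤1+n 1) (ℕₚ.≤-trans 2≤δ (δ≤deg v)))) zf
... | v , u , u≢v , w , x , cover = subst (2 * δ ∸ 2 ≤_) ∣S∣≡z (ℕₚ.∸-monoˡ-≤ 2 (begin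
  2 * δ                           ≡⟨ cong (δ +_) (ℕₚ.+-identityʳ δ) ⟩
  δ + δ                           ≤⟨ ℕₚ.+-mono-≤ (δ≤deg v) (δ≤deg u) ⟩
  deg G v + deg G u               ≤⟨ deg+deg≤∣Nc∪Nc∣ G girth≥5 u≢v ⟩
  ∣ Nc G v ∪ Nc G u ∣             ≤⟨ p⊆q⇒∣p∣≤∣q∣ cover ⟩
  ∣ (S ∪ ⁅ w ⁆) ∪ ⁅ x ⁆ ∣         ≤⟨ ∣S∪⁅w⁆∪⁅x⁆∣≤2+∣S∣ S w x ⟩
  2 + ∣ S ∣                       ∎))
  where open ℕₚ.≤-Reasoning
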